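{- Let $n=2m>3$ be an even integer and let $a,b$ be natural numbers with $1\le a<b\le n-1$. If $a$ and $b$ are both even and $\gcd(a+b,n)=2$, then $a$ and $b$ do not induce an $n$-polygon with $m$ axes, i.e. the $n$-tuple of sides $(a,b,a,b,\ldots,a,b)$ does not represent an $n$-polygon with $m$ axes.
   Context: Fix the vertices $v_k=e^{2\pi i k/n}$, $k=0,\ldots,n-1$, on the unit circle. An $n$-polygon is a Hamiltonian cycle through these vertices: a closed path $v_{\sigma_1}\cdots v_{\sigma_n}v_{\sigma_1}$ of straight segments with $(\sigma_1,\ldots,\sigma_n)$ an ordering of $0,\ldots,n-1$. Its sides are the integers $e_i\in\{1,\ldots,n-1\}$ with $e_i\equiv\sigma_{i+1}-\sigma_i\pmod n$; an $n$-tuple of sides represents a polygon if starting at a vertex and moving counterclockwise successively by the sides visits each vertex exactly once before returning to the start after the $n$-th step. An $n$-polygon with $m$ axes is one with exactly $m$ axes of reflection symmetry. -}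

module Defs where

open import Data.Nat using (ℕ; zero; suc; _+_; _∸_; _<_; _≤_; _%_)
open import Data.Product using (Σ; _×_; ∃-syntax)
open import Data.Sum using (_⊎_)
open import Data.List using (List; length)
open import Data.List.Relation.Unary.Unique.Propositional using (Unique)
open import Data.List.Membership.Propositional using (_∈_)
open import Relation.Binary.PropositionalEquality using (_≡_)
open import Relation.Nullary using (¬_)

-- Vertex v_k is represented by its index k ∈ {0,…,n-1}.
-- Total "mod n" (only used with n > 0).
_modN_ : ℕ → ℕ → ℕ
k modN zero    = k
k modN (suc n) = k % suc n

-- Sides given as a function e : ℕ → ℕ, with e i the i-th side (i = 0,…,n-1).
-- pos n s e i = vertex reached after i steps when starting at vertex s.
pos : (n s : ℕ) → (ℕ → ℕ) → ℕ → ℕ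
pos n s e zero    = s modN n
pos n s e (suc i) = (pos n s e i + e i) modN n

Represents : (n s : ℕ) → (ℕ → ℕ) → Set
Represents n s e =
  (∀ i → i < n → 1 ≤ e i × e i ≤ n ∸ 1) ×
  (∀ i j → i < n → j < n → pos n s e i ≡ pos n s e j → i ≡ j) ×
  (pos n s e n ≡ pos n s e 0)

SameSeg : ℕ → ℕ → ℕ → ℕ → Set
SameSeg x y u v = (x ≡ u × y ≡ v) ⊎ (x ≡ v × y ≡ u)

HasSeg : (n s : ℕ) → (ℕ → ℕ) → ℕ → ℕ → Set
HasSeg n s e x y = ∃[ i ] (i < n × SameSeg (pos n s e i) (pos n s e (suc i)) x y)

-- The reflections of the vertex set: v_k ↦ v_{c-k}, c = 0,…,n-1
-- (the n reflection axes of the regular n-gon; distinct c give distinct axes).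
reflect : (n c k : ℕ) → ℕ
reflect n c k = (c + (n ∸ k)) modN n

-- The reflection indexed by c is a symmetry of the polygon: it maps every side
-- to a side (hence permutes the finite set of sides).
IsAxis : (n s : ℕ) → (ℕ → ℕ) → ℕ → Set
IsAxis n s e c =
  ∀ i → i < n → HasSeg n s e (reflect n c (pos n s e i)) (reflect n c (pos n s e (suc i)))

HasExactlyAxes : (n s : ℕ) → (ℕ → ℕ) → ℕ → Set
HasExactlyAxes n s e m =
  Σ (List ℕ) λ L → Unique L × length L ≡ m ×
    (∀ c → (c ∈ L → c < n × IsAxis n s e c) × (c < n × IsAxis n s e c → c ∈ L))

alt : ℕ → ℕ → ℕ → ℕ
alt a b zero    = a
alt a b (suc i) = alt b a i

-- All sides are even and so is n, so every vertex visited has the parity of the starting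
-- vertex.  Only m = n/2 vertices have that parity, so the first n steps cannot visit n
-- distinct vertices: no polygon at all has these sides, let alone one with m axes.
module Submission where

open import Defs
open import Data.Nat using (ℕ; zero; suc; _+_; _*_; _∸_; _<_; _≤_; _%_; _/_; NonZero; s≤s; z≤n)
open import Data.Nat.Properties using (*-comm; <⇒≱)
open import Data.Nat.Divisibility using (_∣_; divides)
open import Data.Nat.DivMod
  using (m≡m%n+[m/n]*n; m%n<n; %-remove-+ʳ; m∣n⇒o%n%m≡o%m; m<n*o⇒m/o<n; m/n*n≡m; m/n<m)
open import Data.Nat.GCD using (gcd)
open import Data.Fin using (Fin; toℕ; fromℕ<)
open import Data.Fin.Properties using (toℕ<n; toℕ-fromℕ<; toℕ-injective; injective⇒≤)
open import Data.Product using (_×_; _,_)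
open import Relation.Binary.PropositionalEquality using (_≡_; refl; sym; trans; cong; cong₂; subst; module ≡-Reasoning)
open import Relation.Nullary using (¬_)

alt-∣ : ∀ {d a b} → d ∣ a → d ∣ b → ∀ i → d ∣ alt a b i
alt-∣ d∣a d∣b zero    = d∣a
alt-∣ d∣a d∣b (suc i) = alt-∣ d∣b d∣a i

modN≡% : ∀ k n .{{_ : NonZero n}} → k modN n ≡ k % n
modN≡% k (suc n) = refl

pos<n : ∀ n .{{_ : NonZero n}} s e i → pos n s e i < n
pos<n n s e zero    = subst (_< n) (sym (modN≡% s n)) (m%n<n s n)
pos<n n s e (suc i) = subst (_< n) (sym (modN≡% (pos n s e i + e i) n)) (m%n<n _ n)

pos%≡start% : ∀ {n d} .{{_ : NonZero n}} .{{_ : NonZero d}} → d ∣ n →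
  ∀ s e → (∀ i → d ∣ e i) → ∀ i → pos n s e i % d ≡ s % d
pos%≡start% {n} {d} d∣n s e d∣e zero = begin
  s modN n % d ≡⟨ cong (_% d) (modN≡% s n) ⟩
  s % n % d    ≡⟨ m∣n⇒o%n%m≡o%m d n s d∣n ⟩
  s % d        ∎
  where open ≡-Reasoning
pos%≡start% {n} {d} d∣n s e d∣e (suc i) = begin
  (pos n s e i + e i) modN n % d ≡⟨ cong (_% d) (modN≡% (pos n s e i + e i) n) ⟩
  (pos n s e i + e i) % n % d    ≡⟨ m∣n⇒o%n%m≡o%m d n _ d∣n ⟩
  (pos n s e i + e i) % d        ≡⟨ %-remove-+ʳ (pos n s e i) (d∣e i) ⟩
  pos n s e i % d                ≡⟨ pos%≡start% d∣n s e d∣e i ⟩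
  s % d                          ∎
  where open ≡-Reasoning

%-/-injective : ∀ {x y} d .{{_ : NonZero d}} → x % d ≡ y % d → x / d ≡ y / d → x ≡ y
%-/-injective {x} {y} d x%d≡y%d x/d≡y/d = begin
  x                   ≡⟨ m≡m%n+[m/n]*n x d ⟩
  x % d + (x / d) * d ≡⟨ cong₂ (λ r q → r + q * d) x%d≡y%d x/d≡y/d ⟩
  y % d + (y / d) * d ≡⟨ sym (m≡m%n+[m/n]*n y d) ⟩
  y                   ∎
  where open ≡-Reasoning

¬Represents-commonDivisor : ∀ {n d} .{{_ : NonZero n}} → 2 ≤ d → d ∣ n →
  ∀ s e → (∀ i → d ∣ e i) → ¬ Represents n s e
¬Represents-commonDivisor {n} {d} 2≤d@(s≤s (s≤s _)) d∣n s e d∣e (_ , distinct , _) =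
  <⇒≱ (m/n<m n d 2≤d) (injective⇒≤ {f = block} block-injective)
  where
    vertex : Fin n → ℕ
    vertex i = pos n s e (toℕ i)

    vertex/d<n/d : ∀ i → vertex i / d < n / d
    vertex/d<n/d i = m<n*o⇒m/o<n (subst (vertex i <_) (sym (m/n*n≡m d∣n)) (pos<n n s e (toℕ i)))

    block : Fin n → Fin (n / d)
    block i = fromℕ< (vertex/d<n/d i)

    block-injective : ∀ {i j} → block i ≡ block j → i ≡ j
    block-injective {i} {j} bi≡bj = toℕ-injective (distinct (toℕ i) (toℕ j) (toℕ<n i) (toℕ<n j)
      (%-/-injective d
        (trans (pos%≡start% d∣n s e d∣e (toℕ i)) (sym (pos%≡start% d∣n s e d∣e (toℕ j))))
        (trans (sym (toℕ-fromℕ< (vertex/d<n/d i)))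
               (trans (cong toℕ bi≡bj) (toℕ-fromℕ< (vertex/d<n/d j))))))

theorem5 : (m a b : ℕ) → 3 < 2 * m → 1 ≤ a → a < b → b ≤ 2 * m ∸ 1 →
    2 ∣ a → 2 ∣ b → gcd (a + b) (2 * m) ≡ 2 →
    (s : ℕ) → s < 2 * m →
    ¬ (Represents (2 * m) s (alt a b) × HasExactlyAxes (2 * m) s (alt a b) m)
theorem5 zero _ _ () _ _ _ _ _ _ _ _
theorem5 (suc k) a b _ _ _ _ 2∣a 2∣b _ s _ (represents , _) =
  ¬Represents-commonDivisor (s≤s (s≤s z≤n)) (divides (suc k) (*-comm 2 (suc k)))
    s (alt a b) (alt-∣ 2∣a 2∣b) represents
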